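{- Let $\Lambda$ be a symplectic lattice of type $(d_1,\dots,d_g)$ with $d_1=d_2=1$. Every primitive vector of $\Lambda$ is splitting if and only if the integers $d_3,\ d_4/d_3,\ \dots,\ d_g/d_{g-1}$ are square-free and pairwise coprime.
   Context: A symplectic lattice is a free $\mathbb{Z}$-module $\Lambda$ of rank $2g$ with a nondegenerate alternating bilinear form $(\cdot,\cdot)\colon\Lambda\times\Lambda\to\mathbb{Z}$. Let $U$ be the rank-2 lattice with Gram matrix $\begin{pmatrix}0&1\\-1&0\end{pmatrix}$ and $U(d)$ its form scaled by $d$. Every symplectic lattice is isometric to $U(d_1)\oplus\cdots\oplus U(d_g)$ with positive integers $d_i\mid d_{i+1}$; $(d_1,\dots,d_g)$ is its type. A vector $v\in\Lambda$ is primitive if $\mathbb{Q}v\cap\Lambda=\mathbb{Z}v$; a primitive vector $v$ is splitting if it lies in a rank-2 sublattice $\Lambda_1$ with $\Lambda=\Lambda_1\oplus\Lambda_1^\perp$. -}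

module Defs where

open import Data.Nat as ℕ using (ℕ; zero; suc)
open import Data.Nat.Divisibility using (_∣_; quotient)
open import Data.Nat.Coprimality using (Coprime)
open import Data.Integer as ℤ using (ℤ; +_; _*_; _+_; _-_)
open import Data.Fin using (Fin; zero; suc; inject₁)
open import Data.Product using (_×_; _,_; proj₁; proj₂; Σ; ∃; ∃-syntax)
open import Relation.Binary.PropositionalEquality using (_≡_; _≢_)
open import Relation.Nullary using (¬_)

∑ : ∀ {n} → (Fin n → ℤ) → ℤ
∑ {zero}  f = + 0
∑ {suc n} f = f zero + ∑ (λ i → f (suc i))

-- The underlying Z-module of U(d_1) ⊕ ... ⊕ U(d_g): Z^{2g}, written as
-- g pairs (x_i , y_i), the i-th pair being the basis coordinates in U(d_i).
Λ : ℕ → Set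
Λ g = Fin g → ℤ × ℤ

module _ {g : ℕ} where

  _≈_ : Λ g → Λ g → Set
  u ≈ v = ∀ i → u i ≡ v i

  𝟎 : Λ g
  𝟎 _ = (+ 0 , + 0)

  _⊕_ : Λ g → Λ g → Λ g
  (u ⊕ v) i = (proj₁ (u i) + proj₁ (v i) , proj₂ (u i) + proj₂ (v i))

  _⊖_ : Λ g → Λ g → Λ g
  (u ⊖ v) i = (proj₁ (u i) - proj₁ (v i) , proj₂ (u i) - proj₂ (v i))

  _·_ : ℤ → Λ g → Λ g
  (k · v) i = (k * proj₁ (v i) , k * proj₂ (v i))

  form : (d : Fin g → ℕ) → Λ g → Λ g → ℤ
  form d u v = ∑ λ i → (+ d i) * (proj₁ (u i) * proj₂ (v i) - proj₂ (u i) * proj₁ (v i))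

  -- v is primitive: Qv ∩ Λ = Zv, i.e. whenever q·w = p·v with q ≠ 0, w ∈ Zv.
  Primitive : Λ g → Set
  Primitive v = ∀ (w : Λ g) (p q : ℤ) → q ≢ + 0 → (q · w) ≈ (p · v) →
                ∃[ k ] (w ≈ (k · v))

  -- v is splitting (for the form given by d): v is primitive and lies in a
  -- rank-2 sublattice Λ₁ = Ze ⊕ Zf (e, f linearly independent) such that
  -- Λ = Λ₁ ⊕ Λ₁^⊥ (every x decomposes as an element of Λ₁ plus an element of
  -- Λ₁^⊥, and Λ₁ ∩ Λ₁^⊥ = 0).
  Splitting : (d : Fin g → ℕ) → Λ g → Set
  Splitting d v =
    Primitive v ×
    ∃[ e ] ∃[ f ]
      ((∀ a b → ((a · e) ⊕ (b · f)) ≈ 𝟎 → (a ≡ + 0) × (b ≡ + 0)) ×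
       (∃[ a ] ∃[ b ] (v ≈ ((a · e) ⊕ (b · f)))) ×
       (∀ x → ∃[ a ] ∃[ b ]
          (form d (x ⊖ ((a · e) ⊕ (b · f))) e ≡ + 0 ×
           form d (x ⊖ ((a · e) ⊕ (b · f))) f ≡ + 0)) ×
       (∀ a b → form d ((a · e) ⊕ (b · f)) e ≡ + 0 →
                form d ((a · e) ⊕ (b · f)) f ≡ + 0 →
                ((a · e) ⊕ (b · f)) ≈ 𝟎))

SquareFree : ℕ → Set
SquareFree n = ∀ k → k ℕ.* k ∣ n → k ≡ 1

record IsType {m : ℕ} (d : Fin (suc m) → ℕ) : Set where
  field
    positive : ∀ i → 0 ℕ.< d i
    chain    : ∀ (i : Fin m) → d (inject₁ i) ∣ d (suc i)

{-# OPTIONS --safe #-}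
module Submission where

open import Defs
open import Data.Nat using (ℕ; suc)
open import Data.Nat.Divisibility using (_∣_; quotient)
open import Data.Nat.Coprimality using (Coprime)
open import Data.Fin using (Fin; zero; suc)
open import Data.Product using (_×_)
open import Relation.Binary.PropositionalEquality using (_≡_; _≢_)
open import Function.Bundles using (_⇔_)

open import Data.Empty using (⊥-elim)
import Data.Fin as Fin
open import Data.Fin using (inject₁; fromℕ)
import Data.Fin.Properties as FinP
open import Data.Integer as ℤ using (ℤ; +_; -_; _+_; _-_; _*_; -1ℤ)
import Data.Integer.Divisibility.Signed as ℤ∣
open ℤ∣ using (divides) renaming (_∣_ to _∣ᶻ_)
import Data.Integer.GCD as ℤGCD
import Data.Integer.Properties as ℤP
open import Data.Integer.Tactic.RingSolver using (solve-∀; solve)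
open import Data.List using (_∷_; [])
import Data.Nat as ℕ
open import Data.Nat using (zero)
import Data.Nat.Coprimality as Coprimality
import Data.Nat.Divisibility as ℕ∣
import Data.Nat.GCD as ℕGCD
import Data.Nat.Properties as ℕP
open import Data.Product using (_,_; proj₁; proj₂; ∃-syntax)
open import Data.Sum using (_⊎_; inj₁; inj₂; [_,_]′)
open import Function.Base using (_∘_)
open import Function.Bundles using (mk⇔; module Equivalence)
open import Relation.Binary.Definitions using (tri<; tri≈; tri>)
open import Relation.Binary.PropositionalEquality
  using (refl; sym; trans; cong; cong₂; subst; _≗_; module ≡-Reasoning)
open import Relation.Nullary using (¬_)
import Algebra.Properties.Semiring.Sum ℤP.+-*-semiring as Sum

-- Write ⟨u , x⟩ for the form.  A plane ℤe ⊕ ℤf with c = ⟨e , f⟩ ≠ 0 is an orthogonal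
-- direct summand exactly when c divides ⟨e , x⟩ and ⟨f , x⟩ for all x.  As d₁ = d₂ = 1,
-- the conditions on d₃, d₄/d₃, …, d_g/d_{g-1} say precisely that D = d_g is square-free.
--
-- If D is square-free, let v ≠ 0 be primitive, pick ℓ with v·ℓ = 1, and let c generate
-- the ideal of values ⟨v , x⟩, attained at x₀.  Scaling ℓ coordinatewise by D/dᵢ and
-- rotating each pair gives f′ with ⟨v , f′⟩ = D and D ∣ ⟨f′ , ·⟩.  So c ∣ D, hence c is
-- coprime to D/c, and a Bézout combination f of x₀ and f′ has ⟨v , f⟩ = c and
-- c ∣ ⟨f , ·⟩: the plane ℤv ⊕ ℤf splits off.
--
-- If p² ∣ d_j with p ≥ 2, let (e₀, f₀) be the basis of the block U(d₁) = U(1) and e_j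
-- the first basis vector of U(d_j).  Then v = (d_j/p)e₀ + e_j is primitive and
-- ⟨v , x⟩ = (d_j/p)(y₀ + p y_j), where yᵢ is the second coordinate of x in U(dᵢ).  For
-- a splitting pair with v = ae + bf, c = ⟨e , f⟩ divides every ⟨v , x⟩, hence d_j/p, and
-- also ⟨e₀ , e⟩ = y₀(e) and ⟨e₀ , f⟩ = y₀(f).  Comparing ac = ⟨v , f⟩ and -bc = ⟨v , e⟩
-- with the formula gives p ∣ a and p ∣ b, absurd as the e_j-coordinate of ae + bf is 1.

∑≡sum : ∀ {n} (f : Fin n → ℤ) → ∑ f ≡ Sum.sum f
∑≡sum {zero}  f = refl
∑≡sum {suc n} f = cong (λ s → f zero + s) (∑≡sum (f ∘ suc))

∑-cong : ∀ {n} {f h : Fin n → ℤ} → f ≗ h → ∑ f ≡ ∑ h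
∑-cong {f = f} {h} f≗h = trans (∑≡sum f) (trans (Sum.sum-cong-≗ f≗h) (sym (∑≡sum h)))

∑-distrib-+ : ∀ {n} (f h : Fin n → ℤ) → ∑ (λ i → f i + h i) ≡ ∑ f + ∑ h
∑-distrib-+ f h = trans (∑≡sum (λ i → f i + h i))
  (trans (Sum.∑-distrib-+ f h) (sym (cong₂ _+_ (∑≡sum f) (∑≡sum h))))

*-distribˡ-∑ : ∀ {n} k (f : Fin n → ℤ) → k * ∑ f ≡ ∑ (λ i → k * f i)
*-distribˡ-∑ k f = trans (cong (k *_) (∑≡sum f))
  (trans (Sum.*-distribˡ-sum k f) (sym (∑≡sum (λ i → k * f i))))

∑-zero : ∀ {n} {f : Fin n → ℤ} → (∀ i → f i ≡ + 0) → ∑ f ≡ + 0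
∑-zero {n} f≗0 = trans (∑-cong f≗0) (trans (∑≡sum {n} (λ _ → + 0)) (Sum.sum-replicate-zero n))

∣-∑ : ∀ {n k} {f : Fin n → ℤ} → (∀ i → k ∣ᶻ f i) → k ∣ᶻ ∑ f
∣-∑ {zero}  k∣f = divides (+ 0) refl
∣-∑ {suc n} k∣f = ℤ∣.∣m∣n⇒∣m+n (k∣f zero) (∣-∑ (k∣f ∘ suc))

_⊙_ : ∀ {g} → (Fin g → ℕ) → Λ g → Λ g
(d ⊙ u) i = (+ d i * proj₁ (u i) , + d i * proj₂ (u i))

infix 4 _∣ᴧ_
_∣ᴧ_ : ∀ {g} → ℤ → Λ g → Set
k ∣ᴧ w = ∀ i → k ∣ᶻ proj₁ (w i) × k ∣ᶻ proj₂ (w i)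

dot : ∀ {g} → Λ g → Λ g → ℤ
dot u z = ∑ λ i → proj₁ (u i) * proj₁ (z i) + proj₂ (u i) * proj₂ (z i)

J : ∀ {g} → Λ g → Λ g
J z i = (- proj₂ (z i) , proj₁ (z i))

single : ∀ {g} → Fin g → ℤ × ℤ → Λ g
single zero    p zero    = p
single zero    p (suc _) = (+ 0 , + 0)
single (suc j) p zero    = (+ 0 , + 0)
single (suc j) p (suc i) = single j p i

single-at : ∀ {g} (j : Fin g) p → single j p j ≡ p
single-at zero    p = refl
single-at (suc j) p = single-at j p

module FormProperties {g : ℕ} (d : Fin g → ℕ) where
  open ≡-Reasoning

  private
    term : Λ g → Λ g → Fin g → ℤ
    term u x i = + d i * (proj₁ (u i) * proj₂ (x i) - proj₂ (u i) * proj₁ (x i))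

  form-congˡ : ∀ {u u′} x → u ≈ u′ → form d u x ≡ form d u′ x
  form-congˡ x u≈u′ =
    ∑-cong (λ i → cong (λ p → + d i * (proj₁ p * proj₂ (x i) - proj₂ p * proj₁ (x i))) (u≈u′ i))

  form-lincombˡ : ∀ a u b w x → form d ((a · u) ⊕ (b · w)) x ≡ a * form d u x + b * form d w x
  form-lincombˡ a u b w x = begin
    form d ((a · u) ⊕ (b · w)) x
      ≡⟨ ∑-cong (λ i → bilinear (+ d i) a b (u i) (w i) (x i)) ⟩
    ∑ (λ i → a * term u x i + b * term w x i)
      ≡⟨ ∑-distrib-+ (λ i → a * term u x i) (λ i → b * term w x i) ⟩
    ∑ (λ i → a * term u x i) + ∑ (λ i → b * term w x i)
      ≡⟨ cong₂ _+_ (*-distribˡ-∑ a (term u x)) (*-distribˡ-∑ b (term w x)) ⟨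
    a * form d u x + b * form d w x
      ∎
    where
    bilinear : ∀ D a b ((u₁ , u₂) (w₁ , w₂) (x₁ , x₂) : ℤ × ℤ) →
      D * ((a * u₁ + b * w₁) * x₂ - (a * u₂ + b * w₂) * x₁) ≡
      a * (D * (u₁ * x₂ - u₂ * x₁)) + b * (D * (w₁ * x₂ - w₂ * x₁))
    bilinear D a b (u₁ , u₂) (w₁ , w₂) (x₁ , x₂) =
      solve (D ∷ a ∷ b ∷ u₁ ∷ u₂ ∷ w₁ ∷ w₂ ∷ x₁ ∷ x₂ ∷ [])

  form-⊖ˡ : ∀ u w x → form d (u ⊖ w) x ≡ form d u x - form d w x
  form-⊖ˡ u w x = begin
    form d (u ⊖ w) x
      ≡⟨ ∑-cong (λ i → linear (+ d i) (u i) (w i) (x i)) ⟩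
    ∑ (λ i → term u x i + -1ℤ * term w x i)
      ≡⟨ ∑-distrib-+ (term u x) (λ i → -1ℤ * term w x i) ⟩
    form d u x + ∑ (λ i → -1ℤ * term w x i)
      ≡⟨ cong (λ s → form d u x + s) (*-distribˡ-∑ -1ℤ (term w x)) ⟨
    form d u x + -1ℤ * form d w x
      ≡⟨ cong (λ s → form d u x + s) (ℤP.-1*i≡-i (form d w x)) ⟩
    form d u x - form d w x
      ∎
    where
    linear : ∀ D ((u₁ , u₂) (w₁ , w₂) (x₁ , x₂) : ℤ × ℤ) →
      D * ((u₁ - w₁) * x₂ - (u₂ - w₂) * x₁) ≡
      D * (u₁ * x₂ - u₂ * x₁) + -1ℤ * (D * (w₁ * x₂ - w₂ * x₁))
    linear D (u₁ , u₂) (w₁ , w₂) (x₁ , x₂) = solve (D ∷ u₁ ∷ u₂ ∷ w₁ ∷ w₂ ∷ x₁ ∷ x₂ ∷ [])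

  form-antisym : ∀ u x → form d u x ≡ - form d x u
  form-antisym u x = begin
    form d u x                ≡⟨ ∑-cong (λ i → antisym (+ d i) (u i) (x i)) ⟩
    ∑ (λ i → -1ℤ * term x u i) ≡⟨ *-distribˡ-∑ -1ℤ (term x u) ⟨
    -1ℤ * form d x u          ≡⟨ ℤP.-1*i≡-i (form d x u) ⟩
    - form d x u              ∎
    where
    antisym : ∀ D ((u₁ , u₂) (x₁ , x₂) : ℤ × ℤ) →
      D * (u₁ * x₂ - u₂ * x₁) ≡ -1ℤ * (D * (x₁ * u₂ - x₂ * u₁))
    antisym D (u₁ , u₂) (x₁ , x₂) = solve (D ∷ u₁ ∷ u₂ ∷ x₁ ∷ x₂ ∷ [])

  form-self : ∀ u → form d u u ≡ + 0
  form-self u = ∑-zero (λ i → alternating (+ d i) (u i))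
    where
    alternating : ∀ D ((u₁ , u₂) : ℤ × ℤ) → D * (u₁ * u₂ - u₂ * u₁) ≡ + 0
    alternating D (u₁ , u₂) = solve (D ∷ u₁ ∷ u₂ ∷ [])

  form-𝟎ˡ : ∀ x → form d 𝟎 x ≡ + 0
  form-𝟎ˡ x = ∑-zero (λ i → ℤP.*-zeroʳ (+ d i))

  form-lincombʳ : ∀ x a u b w → form d x ((a · u) ⊕ (b · w)) ≡ a * form d x u + b * form d x w
  form-lincombʳ x a u b w = begin
    form d x ((a · u) ⊕ (b · w))
      ≡⟨ form-antisym x _ ⟩
    - form d ((a · u) ⊕ (b · w)) x
      ≡⟨ cong -_ (form-lincombˡ a u b w x) ⟩
    - (a * form d u x + b * form d w x)
      ≡⟨ cong₂ (λ s t → - (a * s + b * t)) (form-antisym u x) (form-antisym w x) ⟩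
    - (a * - form d x u + b * - form d x w)
      ≡⟨ negate-both a b (form d x u) (form d x w) ⟩
    a * form d x u + b * form d x w
      ∎
    where
    negate-both : ∀ a b p q → - (a * - p + b * - q) ≡ a * p + b * q
    negate-both = solve-∀

  form-span-e : ∀ a e b f → form d ((a · e) ⊕ (b · f)) e ≡ - (b * form d e f)
  form-span-e a e b f = begin
    form d ((a · e) ⊕ (b · f)) e
      ≡⟨ form-lincombˡ a e b f e ⟩
    a * form d e e + b * form d f e
      ≡⟨ cong₂ (λ s t → a * s + b * t) (form-self e) (form-antisym f e) ⟩
    a * + 0 + b * - form d e f
      ≡⟨ simplify a b (form d e f) ⟩
    - (b * form d e f)
      ∎
    where
    simplify : ∀ a b c → a * + 0 + b * - c ≡ - (b * c)
    simplify = solve-∀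

  form-span-f : ∀ a e b f → form d ((a · e) ⊕ (b · f)) f ≡ a * form d e f
  form-span-f a e b f = begin
    form d ((a · e) ⊕ (b · f)) f
      ≡⟨ form-lincombˡ a e b f f ⟩
    a * form d e f + b * form d f f
      ≡⟨ cong (λ t → a * form d e f + b * t) (form-self f) ⟩
    a * form d e f + b * + 0
      ≡⟨ simplify a b (form d e f) ⟩
    a * form d e f
      ∎
    where
    simplify : ∀ a b c → a * c + b * + 0 ≡ a * c
    simplify = solve-∀

  form-⊖ˡ≡0⇔ : ∀ x y z → form d (x ⊖ y) z ≡ + 0 ⇔ form d x z ≡ form d y z
  form-⊖ˡ≡0⇔ x y z = mk⇔
    (λ x⊖y·z≡0 → ℤP.i-j≡0⇒i≡j _ _ (trans (sym (form-⊖ˡ x y z)) x⊖y·z≡0))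
    (λ x·z≡y·z → trans (form-⊖ˡ x y z) (ℤP.i≡j⇒i-j≡0 x·z≡y·z))

  form-J : ∀ u z → form d u (J z) ≡ dot (d ⊙ u) z
  form-J u z = ∑-cong (λ i → expand (+ d i) (u i) (z i))
    where
    expand : ∀ D ((u₁ , u₂) (z₁ , z₂) : ℤ × ℤ) →
             D * (u₁ * z₁ - u₂ * - z₂) ≡ D * u₁ * z₁ + D * u₂ * z₂
    expand D (u₁ , u₂) (z₁ , z₂) = solve (D ∷ u₁ ∷ u₂ ∷ z₁ ∷ z₂ ∷ [])

  ∣-form : ∀ {k} u → k ∣ᴧ (d ⊙ u) → ∀ x → k ∣ᶻ form d u x
  ∣-form {k} u k∣du x = ∣-∑ λ i →
    subst (k ∣ᶻ_) (sym (expand (+ d i) (u i) (x i)))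
          (ℤ∣.∣m∣n⇒∣m-n (ℤ∣.∣m⇒∣m*n _ (proj₁ (k∣du i))) (ℤ∣.∣m⇒∣m*n _ (proj₂ (k∣du i))))
    where
    expand : ∀ D ((u₁ , u₂) (x₁ , x₂) : ℤ × ℤ) →
             D * (u₁ * x₂ - u₂ * x₁) ≡ D * u₁ * x₂ - D * u₂ * x₁
    expand D (u₁ , u₂) (x₁ , x₂) = solve (D ∷ u₁ ∷ u₂ ∷ x₁ ∷ x₂ ∷ [])

  ∣-form-swap : ∀ {k} x y → k ∣ᶻ form d x y → k ∣ᶻ form d y x
  ∣-form-swap {k} x y k∣xy = subst (k ∣ᶻ_) (sym (form-antisym y x)) (ℤ∣.∣m⇒∣-m k∣xy)

form-single : ∀ {g} (d : Fin g → ℕ) j a b x →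
              form d (single j (a , b)) x ≡ + d j * (a * proj₂ (x j) - b * proj₁ (x j))
form-single d zero a b x =
  trans (cong (λ s → + d zero * (a * proj₂ (x zero) - b * proj₁ (x zero)) + s)
              (∑-zero (λ i → ℤP.*-zeroʳ (+ d (suc i)))))
        (ℤP.+-identityʳ _)
form-single d (suc j) a b x =
  trans (cong₂ _+_ (ℤP.*-zeroʳ (+ d zero)) (form-single (d ∘ suc) j a b (x ∘ suc)))
        (ℤP.+-identityˡ _)

EveryPrimitiveSplits : ∀ {g} → (Fin g → ℕ) → Set
EveryPrimitiveSplits {g} d = ∀ (v : Λ g) → Primitive v → Splitting d v

module _ {g : ℕ} (d : Fin g → ℕ) where
  open FormProperties d
  open ≡-Reasoning

  Decomposes : Λ g → Λ g → Set
  Decomposes e f = ∀ x → ∃[ a ] ∃[ b ]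
    (form d (x ⊖ ((a · e) ⊕ (b · f))) e ≡ + 0 × form d (x ⊖ ((a · e) ⊕ (b · f))) f ≡ + 0)

  decomposes⇒∣ : ∀ e f → Decomposes e f → ∀ x →
                 form d e f ∣ᶻ form d x e × form d e f ∣ᶻ form d x f
  decomposes⇒∣ e f decomp x with decomp x
  ... | a , b , ⊥e , ⊥f = divides (- b) x·e , divides a x·f
    where
    x·e : form d x e ≡ - b * form d e f
    x·e = begin
      form d x e                     ≡⟨ Equivalence.to (form-⊖ˡ≡0⇔ x _ e) ⊥e ⟩
      form d ((a · e) ⊕ (b · f)) e   ≡⟨ form-span-e a e b f ⟩
      - (b * form d e f)             ≡⟨ ℤP.neg-distribˡ-* b (form d e f) ⟩
      - b * form d e f               ∎
    x·f : form d x f ≡ a * form d e f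
    x·f = trans (Equivalence.to (form-⊖ˡ≡0⇔ x _ f) ⊥f) (form-span-f a e b f)

  decomposes⇒∣-span : ∀ e f → Decomposes e f → ∀ a b x →
                      form d e f ∣ᶻ form d ((a · e) ⊕ (b · f)) x
  decomposes⇒∣-span e f decomp a b x =
    subst (form d e f ∣ᶻ_) (sym (form-lincombˡ a e b f x))
      (ℤ∣.∣m∣n⇒∣m+n (ℤ∣.∣n⇒∣m*n a (∣-form-swap x e (proj₁ (decomposes⇒∣ e f decomp x))))
                    (ℤ∣.∣n⇒∣m*n b (∣-form-swap x f (proj₂ (decomposes⇒∣ e f decomp x)))))

  ∣⇒decomposes : ∀ e f → (∀ x → form d e f ∣ᶻ form d e x) → (∀ x → form d e f ∣ᶻ form d f x) →
                 Decomposes e f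
  ∣⇒decomposes e f ∣e· ∣f· x =
    a , b , Equivalence.from (form-⊖ˡ≡0⇔ x _ e) x·e , Equivalence.from (form-⊖ˡ≡0⇔ x _ f) x·f
    where
    open ℤ∣._∣_ (∣-form-swap e x (∣e· x)) renaming (quotient to qₑ; equality to x·e≡qₑc)
    open ℤ∣._∣_ (∣-form-swap f x (∣f· x)) renaming (quotient to q_f; equality to x·f≡q_fc)
    a b : ℤ
    a = q_f
    b = - qₑ
    x·e : form d x e ≡ form d ((a · e) ⊕ (b · f)) e
    x·e = begin
      form d x e                     ≡⟨ x·e≡qₑc ⟩
      qₑ * form d e f                ≡⟨ cong (_* form d e f) (ℤP.neg-involutive qₑ) ⟨
      - b * form d e f               ≡⟨ ℤP.neg-distribˡ-* b (form d e f) ⟨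
      - (b * form d e f)             ≡⟨ form-span-e a e b f ⟨
      form d ((a · e) ⊕ (b · f)) e   ∎
    x·f : form d x f ≡ form d ((a · e) ⊕ (b · f)) f
    x·f = trans x·f≡q_fc (sym (form-span-f a e b f))

  span-coefficients-zero : ∀ e f → form d e f ≢ + 0 → ∀ a b →
    form d ((a · e) ⊕ (b · f)) e ≡ + 0 → form d ((a · e) ⊕ (b · f)) f ≡ + 0 →
    a ≡ + 0 × b ≡ + 0
  span-coefficients-zero e f c≢0 a b ⊥e ⊥f =
    cancel a a·c≡0 , ℤP.neg-injective (cancel (- b) -b·c≡0)
    where
    cancel : ∀ k → k * form d e f ≡ + 0 → k ≡ + 0
    cancel k k·c≡0 with ℤP.i*j≡0⇒i≡0∨j≡0 k k·c≡0
    ... | inj₁ k≡0 = k≡0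
    ... | inj₂ c≡0 = ⊥-elim (c≢0 c≡0)
    a·c≡0 : a * form d e f ≡ + 0
    a·c≡0 = trans (sym (form-span-f a e b f)) ⊥f
    -b·c≡0 : - b * form d e f ≡ + 0
    -b·c≡0 = trans (sym (ℤP.neg-distribˡ-* b (form d e f))) (trans (sym (form-span-e a e b f)) ⊥e)

  span-independent : ∀ e f → form d e f ≢ + 0 → ∀ a b → ((a · e) ⊕ (b · f)) ≈ 𝟎 →
                     a ≡ + 0 × b ≡ + 0
  span-independent e f c≢0 a b span≈𝟎 =
    span-coefficients-zero e f c≢0 a b (trans (form-congˡ e span≈𝟎) (form-𝟎ˡ e))
                                       (trans (form-congˡ f span≈𝟎) (form-𝟎ˡ f))

  span-nondegenerate : ∀ e f → form d e f ≢ + 0 → ∀ a b →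
    form d ((a · e) ⊕ (b · f)) e ≡ + 0 → form d ((a · e) ⊕ (b · f)) f ≡ + 0 →
    ((a · e) ⊕ (b · f)) ≈ 𝟎
  span-nondegenerate e f c≢0 a b ⊥e ⊥f i =
    let (a≡0 , b≡0) = span-coefficients-zero e f c≢0 a b ⊥e ⊥f
    in cong₂ (λ a b → ((a · e) ⊕ (b · f)) i) a≡0 b≡0

  splitting-criterion : ∀ {v} e f → Primitive v → form d e f ≢ + 0 →
    (∀ x → form d e f ∣ᶻ form d e x) → (∀ x → form d e f ∣ᶻ form d f x) →
    ∃[ a ] ∃[ b ] (v ≈ ((a · e) ⊕ (b · f))) → Splitting d v
  splitting-criterion e f v-primitive c≢0 ∣e· ∣f· v∈span =
    v-primitive , e , f , span-independent e f c≢0 , v∈span , ∣⇒decomposes e f ∣e· ∣f· ,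
    span-nondegenerate e f c≢0

m+n≡o⇒+o-+n≡+m : ∀ {m n o} → m ℕ.+ n ≡ o → + o - + n ≡ + m
m+n≡o⇒+o-+n≡+m {m} {n} {o} m+n≡o = begin
  + o - + n              ≡⟨ cong (λ k → + k - + n) m+n≡o ⟨
  + (m ℕ.+ n) - + n      ≡⟨ cong (_- + n) (ℤP.pos-+ m n) ⟩
  + m + + n - + n        ≡⟨ cancel (+ m) (+ n) ⟩
  + m                    ∎
  where
  open ≡-Reasoning
  cancel : ∀ x y → x + y - y ≡ x
  cancel = solve-∀

+∣x∣≡x*±1 : ∀ x → ∃[ σ ] (+ ℤ.∣ x ∣ ≡ x * σ)
+∣x∣≡x*±1 x with ℤP.+∣i∣≡i⊎+∣i∣≡-i x
... | inj₁ ∣x∣≡x  = + 1 , trans ∣x∣≡x (sym (ℤP.*-identityʳ x))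
... | inj₂ ∣x∣≡-x = -1ℤ , trans ∣x∣≡-x (trans (sym (ℤP.-1*i≡-i x)) (ℤP.*-comm -1ℤ x))

ℕ-identity⇒ℤ : ∀ {G m n} → ℕGCD.Bézout.Identity G m n →
               ∃[ s ] ∃[ t ] (+ m * s + + n * t ≡ + G)
ℕ-identity⇒ℤ {G} {m} {n} (ℕGCD.Bézout.+- s t G+tn≡sm) =
  + s , - + t , trans (rearrange (+ m) (+ s) (+ n) (+ t))
                      (trans (sym (cong₂ _-_ (ℤP.pos-* s m) (ℤP.pos-* t n)))
                             (m+n≡o⇒+o-+n≡+m G+tn≡sm))
  where
  rearrange : ∀ m s n t → m * s + n * - t ≡ s * m - t * n
  rearrange = solve-∀
ℕ-identity⇒ℤ {G} {m} {n} (ℕGCD.Bézout.-+ s t G+sm≡tn) =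
  - + s , + t , trans (rearrange (+ m) (+ s) (+ n) (+ t))
                      (trans (sym (cong₂ _-_ (ℤP.pos-* t n) (ℤP.pos-* s m)))
                             (m+n≡o⇒+o-+n≡+m G+sm≡tn))
  where
  rearrange : ∀ m s n t → m * - s + n * t ≡ t * n - s * m
  rearrange = solve-∀

bézout-identity : ∀ x y → ∃[ s ] ∃[ t ] (x * s + y * t ≡ ℤGCD.gcd x y)
bézout-identity x y with +∣x∣≡x*±1 x | +∣x∣≡x*±1 y
                        | ℕ-identity⇒ℤ (ℕGCD.Bézout.identity (ℕGCD.gcd-GCD ℤ.∣ x ∣ ℤ.∣ y ∣))
... | σ , ∣x∣≡xσ | τ , ∣y∣≡yτ | s , t , ∣x∣s+∣y∣t≡gcd = σ * s , τ * t , (begin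
  x * (σ * s) + y * (τ * t)        ≡⟨ cong₂ _+_ (ℤP.*-assoc x σ s) (ℤP.*-assoc y τ t) ⟨
  x * σ * s + y * τ * t            ≡⟨ cong₂ (λ a b → a * s + b * t) ∣x∣≡xσ ∣y∣≡yτ ⟨
  + ℤ.∣ x ∣ * s + + ℤ.∣ y ∣ * t    ≡⟨ ∣x∣s+∣y∣t≡gcd ⟩
  ℤGCD.gcd x y                     ∎)
  where open ≡-Reasoning

dot-·ˡ : ∀ {g} k (u : Λ g) z → dot (k · u) z ≡ k * dot u z
dot-·ˡ k u z =
  trans (∑-cong (λ i → pull-out k (u i) (z i)))
        (sym (*-distribˡ-∑ k (λ i → proj₁ (u i) * proj₁ (z i) + proj₂ (u i) * proj₂ (z i))))
  where
  pull-out : ∀ k ((u₁ , u₂) (z₁ , z₂) : ℤ × ℤ) →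
             k * u₁ * z₁ + k * u₂ * z₂ ≡ k * (u₁ * z₁ + u₂ * z₂)
  pull-out k (u₁ , u₂) (z₁ , z₂) = solve (k ∷ u₁ ∷ u₂ ∷ z₁ ∷ z₂ ∷ [])

dot-·ʳ : ∀ {g} (u : Λ g) k z → dot u (k · z) ≡ k * dot u z
dot-·ʳ u k z =
  trans (∑-cong (λ i → pull-out k (u i) (z i)))
        (sym (*-distribˡ-∑ k (λ i → proj₁ (u i) * proj₁ (z i) + proj₂ (u i) * proj₂ (z i))))
  where
  pull-out : ∀ k ((u₁ , u₂) (z₁ , z₂) : ℤ × ℤ) →
             u₁ * (k * z₁) + u₂ * (k * z₂) ≡ k * (u₁ * z₁ + u₂ * z₂)
  pull-out k (u₁ , u₂) (z₁ , z₂) = solve (k ∷ u₁ ∷ u₂ ∷ z₁ ∷ z₂ ∷ [])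

dot-congˡ : ∀ {g} {u u′ : Λ g} z → u ≈ u′ → dot u z ≡ dot u′ z
dot-congˡ z u≈u′ =
  ∑-cong (λ i → cong (λ p → proj₁ p * proj₁ (z i) + proj₂ p * proj₂ (z i)) (u≈u′ i))

gcd-combination : ∀ {g} (u : Λ g) → ∃[ G ] (+ G ∣ᴧ u × ∃[ z ] (dot u z ≡ + G))
gcd-combination {zero} u = 0 , (λ ()) , (λ ()) , refl
gcd-combination {suc g} u
  with bézout-identity (proj₁ (u zero)) (proj₂ (u zero)) | gcd-combination (u ∘ suc)
... | s₀ , t₀ , head≡G₀ | G₁ , G₁∣tail , z₁ , tail≡G₁
  with bézout-identity (ℤGCD.gcd (proj₁ (u zero)) (proj₂ (u zero))) (+ G₁)
... | s , t , G₀s+G₁t≡G = _ , G∣u , z , (begin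
  dot u z
    ≡⟨ cong (_+ dot (u ∘ suc) (t · z₁)) (pull-out x y s s₀ t₀) ⟩
  (x * s₀ + y * t₀) * s + dot (u ∘ suc) (t · z₁)
    ≡⟨ cong (λ b → (x * s₀ + y * t₀) * s + b) (dot-·ʳ (u ∘ suc) t z₁) ⟩
  (x * s₀ + y * t₀) * s + t * dot (u ∘ suc) z₁
    ≡⟨ cong₂ (λ a b → a * s + t * b) head≡G₀ tail≡G₁ ⟩
  G₀ * s + t * + G₁
    ≡⟨ cong (λ b → G₀ * s + b) (ℤP.*-comm t (+ G₁)) ⟩
  G₀ * s + + G₁ * t
    ≡⟨ G₀s+G₁t≡G ⟩
  ℤGCD.gcd G₀ (+ G₁)
    ∎)
  where
  open ≡-Reasoning
  x y G₀ : ℤ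
  x = proj₁ (u zero)
  y = proj₂ (u zero)
  G₀ = ℤGCD.gcd x y
  z : Λ (suc g)
  z zero    = (s * s₀ , s * t₀)
  z (suc i) = (t · z₁) i
  pull-out : ∀ x y s s₀ t₀ → x * (s * s₀) + y * (s * t₀) ≡ (x * s₀ + y * t₀) * s
  pull-out = solve-∀
  G∣G₀ : ℤGCD.gcd G₀ (+ G₁) ∣ᶻ G₀
  G∣G₀ = ℤ∣.∣ᵤ⇒∣ (ℤGCD.gcd[i,j]∣i G₀ (+ G₁))
  G∣G₁ : ℤGCD.gcd G₀ (+ G₁) ∣ᶻ + G₁
  G∣G₁ = ℤ∣.∣ᵤ⇒∣ (ℤGCD.gcd[i,j]∣j G₀ (+ G₁))
  G∣u : ℤGCD.gcd G₀ (+ G₁) ∣ᴧ u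
  G∣u zero    = ℤ∣.∣-trans G∣G₀ (ℤ∣.∣ᵤ⇒∣ (ℤGCD.gcd[i,j]∣i x y)) ,
                ℤ∣.∣-trans G∣G₀ (ℤ∣.∣ᵤ⇒∣ (ℤGCD.gcd[i,j]∣j x y))
  G∣u (suc i) = ℤ∣.∣-trans G∣G₁ (proj₁ (G₁∣tail i)) , ℤ∣.∣-trans G∣G₁ (proj₂ (G₁∣tail i))

entry≡1⇒primitive : ∀ {g} (v : Λ g) j → proj₁ (v j) ≡ + 1 → Primitive v
entry≡1⇒primitive v j vⱼ≡1 w p q q≢0 qw≈pv = k , λ i →
  cong₂ _,_ (cancel (cong proj₁ (qw≈pv i))) (cancel (cong proj₂ (qw≈pv i)))
  where
  open ≡-Reasoning
  instance _ = ℤ.≢-nonZero q≢0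
  k : ℤ
  k = proj₁ (w j)
  p≡qk : p ≡ q * k
  p≡qk = begin
    p                  ≡⟨ ℤP.*-identityʳ p ⟨
    p * + 1            ≡⟨ cong (p *_) vⱼ≡1 ⟨
    p * proj₁ (v j)    ≡⟨ cong proj₁ (qw≈pv j) ⟨
    q * k              ∎
  cancel : ∀ {x y} → q * x ≡ p * y → x ≡ k * y
  cancel {x} {y} qx≡py =
    ℤP.*-cancelˡ-≡ q x (k * y) (trans qx≡py (trans (cong (_* y) p≡qk) (ℤP.*-assoc q k y)))

primitive⇒unimodular : ∀ {g} {v : Λ g} → Primitive v → v ≈ 𝟎 ⊎ ∃[ ℓ ] (dot v ℓ ≡ + 1)
primitive⇒unimodular {g} {v} v-primitive with gcd-combination v
... | zero  , 0∣v , _ =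
  inj₁ (λ i → cong₂ _,_ (ℤ∣.0∣⇒≡0 (proj₁ (0∣v i))) (ℤ∣.0∣⇒≡0 (proj₂ (0∣v i))))
... | suc n , G∣v , ℓ , v·ℓ≡G = inj₂ (ℓ , trans v·ℓ≡G (cong +_ G≡1))
  where
  open ≡-Reasoning
  G : ℕ
  G = suc n
  w : Λ g
  w i = (ℤ∣.quotient (proj₁ (G∣v i)) , ℤ∣.quotient (proj₂ (G∣v i)))
  G·w≈v : ((+ G) · w) ≈ ((+ 1) · v)
  G·w≈v i = cong₂ _,_ (swap (proj₁ (G∣v i))) (swap (proj₂ (G∣v i)))
    where
    swap : ∀ {x} (G∣x : + G ∣ᶻ x) → + G * ℤ∣.quotient G∣x ≡ + 1 * x
    swap {x} (divides q x≡qG) =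
      trans (ℤP.*-comm (+ G) q) (trans (sym x≡qG) (sym (ℤP.*-identityˡ x)))
  w∈ℤv : ∃[ k ] (w ≈ (k · v))
  w∈ℤv = v-primitive w (+ 1) (+ G) (λ ()) G·w≈v
  k : ℤ
  k = proj₁ w∈ℤv
  v≈kGv : v ≈ ((k * + G) · v)
  v≈kGv i =
    cong₂ _,_ (rescale (ℤ∣._∣_.equality (proj₁ (G∣v i))) (cong proj₁ (proj₂ w∈ℤv i)))
              (rescale (ℤ∣._∣_.equality (proj₂ (G∣v i))) (cong proj₂ (proj₂ w∈ℤv i)))
    where
    reorder : ∀ k x G → k * x * G ≡ k * G * x
    reorder = solve-∀
    rescale : ∀ {x q} → x ≡ q * + G → q ≡ k * x → x ≡ k * + G * x
    rescale {x} x≡qG q≡kx = trans x≡qG (trans (cong (_* + G) q≡kx) (reorder k x (+ G)))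
  kG≡1 : k * + G ≡ + 1
  kG≡1 = ℤP.*-cancelʳ-≡ (k * + G) (+ 1) (+ G) (begin
    k * + G * + G          ≡⟨ cong (k * + G *_) v·ℓ≡G ⟨
    k * + G * dot v ℓ      ≡⟨ dot-·ˡ (k * + G) v ℓ ⟨
    dot ((k * + G) · v) ℓ  ≡⟨ dot-congˡ ℓ v≈kGv ⟨
    dot v ℓ                ≡⟨ v·ℓ≡G ⟩
    + G                    ≡⟨ ℤP.*-identityˡ (+ G) ⟨
    + 1 * + G              ∎)
  G≡1 : G ≡ 1
  G≡1 = ℕP.m*n≡1⇒n≡1 ℤ.∣ k ∣ G (trans (sym (ℤP.abs-* k (+ G))) (cong ℤ.∣_∣ kG≡1))

∣-cofactor : ∀ {p C c y z k} → c ≢ + 0 → p ∣ᶻ C → c ∣ᶻ C → c ∣ᶻ y →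
             k * c ≡ C * (y + p * z) → p ∣ᶻ k
∣-cofactor {p} {C} {c} {y} {z} {k} c≢0 p∣C (divides n C≡nc) (divides φ y≡φc) k·c≡ =
  subst (p ∣ᶻ_) (sym k≡Cφ+npz)
        (ℤ∣.∣m∣n⇒∣m+n (ℤ∣.∣m⇒∣m*n φ p∣C) (ℤ∣.∣m⇒∣m*n z (ℤ∣.∣n⇒∣m*n n ℤ∣.∣-refl)))
  where
  instance _ = ℤ.≢-nonZero c≢0
  expand : ∀ C φ c p z n → C ≡ n * c → C * (φ * c + p * z) ≡ (C * φ + n * p * z) * c
  expand C φ c p z n refl = solve (φ ∷ c ∷ p ∷ z ∷ n ∷ [])
  k≡Cφ+npz : k ≡ C * φ + n * p * z
  k≡Cφ+npz = ℤP.*-cancelʳ-≡ k (C * φ + n * p * z) c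
    (trans k·c≡ (trans (cong (λ y → C * (y + p * z)) y≡φc) (expand C φ c p z n C≡nc)))

squareFree-1 : SquareFree 1
squareFree-1 k k*k∣1 = ℕP.m*n≡1⇒m≡1 k k (ℕ∣.∣1⇒≡1 k*k∣1)

¬squareFree-0 : ¬ SquareFree 0
¬squareFree-0 sf with sf 2 (4 ℕ∣.∣0)
... | ()

squareFree-∣ : ∀ {m n} → m ∣ n → SquareFree n → SquareFree m
squareFree-∣ m∣n sf k k*k∣m = sf k (ℕ∣.∣-trans k*k∣m m∣n)

squareFree-*⇒coprime : ∀ {m n} → SquareFree (m ℕ.* n) → Coprime m n
squareFree-*⇒coprime sf (i∣m , i∣n) = sf _ (ℕ∣.*-pres-∣ i∣m i∣n)

coprime-* : ∀ {a b x} → Coprime a x → Coprime b x → Coprime (a ℕ.* b) x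
coprime-* {a} {b} {x} a⊥x b⊥x {i} (i∣ab , i∣x) =
  b⊥x (Coprimality.coprime-divisor i⊥a i∣ab , i∣x)
  where
  i⊥a : Coprime i a
  i⊥a (j∣i , j∣a) = a⊥x (j∣a , ℕ∣.∣-trans j∣i i∣x)

squareFree-* : ∀ {a b} → SquareFree a → SquareFree b → Coprime a b → SquareFree (a ℕ.* b)
squareFree-* {a} {b} sfa sfb a⊥b k k*k∣ab =
  sfb k (Coprimality.coprime-divisor (coprime-* k⊥a k⊥a) k*k∣ab)
  where
  s : ℕ
  s = ℕGCD.gcd k a
  s⊥b : Coprime s b
  s⊥b (j∣s , j∣b) = a⊥b (ℕ∣.∣-trans j∣s (ℕGCD.gcd[m,n]∣n k a) , j∣b)
  s*s∣ba : s ℕ.* s ∣ b ℕ.* a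
  s*s∣ba = ℕ∣.∣-trans (ℕ∣.*-pres-∣ (ℕGCD.gcd[m,n]∣m k a) (ℕGCD.gcd[m,n]∣m k a))
                      (ℕ∣.∣-trans k*k∣ab (ℕ∣.∣-reflexive (ℕP.*-comm a b)))
  k⊥a : Coprime k a
  k⊥a = Coprimality.gcd≡1⇒coprime
          (sfa s (Coprimality.coprime-divisor (coprime-* s⊥b s⊥b) s*s∣ba))

module _ {g : ℕ} (d : Fin g → ℕ) where
  open FormProperties d
  open ≡-Reasoning

  -- The partner is f = ρc·x₀ + τ·f′ for a Bézout relation mτ + cρ = 1 with m = D/c.
  hyperbolic-partner : ∀ e x₀ f′ {c D} → form d e x₀ ≡ + c → form d e f′ ≡ + D →
    (∀ x → + D ∣ᶻ form d f′ x) → c ∣ D → SquareFree D →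
    ∃[ f ] (form d e f ≡ + c × ∀ x → + c ∣ᶻ form d f x)
  hyperbolic-partner e x₀ f′ {c} {D} e·x₀≡c e·f′≡D D∣f′· (ℕ∣.divides m D≡mc) D-squareFree
    with ℕ-identity⇒ℤ (Coprimality.coprime-Bézout
                         (squareFree-*⇒coprime {m} {c} (subst SquareFree D≡mc D-squareFree)))
  ... | τ , ρ , mτ+cρ≡1 = ((ρ * + c) · x₀) ⊕ (τ · f′) , e·f≡c , c∣f·
    where
    +D≡+m*+c : + D ≡ + m * + c
    +D≡+m*+c = trans (cong +_ D≡mc) (ℤP.pos-* m c)
    c∣D : + c ∣ᶻ + D
    c∣D = divides (+ m) +D≡+m*+c
    e·f≡c : form d e (((ρ * + c) · x₀) ⊕ (τ · f′)) ≡ + c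
    e·f≡c = begin
      form d e (((ρ * + c) · x₀) ⊕ (τ · f′))
        ≡⟨ form-lincombʳ e (ρ * + c) x₀ τ f′ ⟩
      ρ * + c * form d e x₀ + τ * form d e f′
        ≡⟨ cong₂ (λ a b → ρ * + c * a + τ * b) e·x₀≡c (trans e·f′≡D +D≡+m*+c) ⟩
      ρ * + c * + c + τ * (+ m * + c)
        ≡⟨ factor ρ τ (+ m) (+ c) ⟩
      (+ m * τ + + c * ρ) * + c
        ≡⟨ cong (_* + c) mτ+cρ≡1 ⟩
      + 1 * + c
        ≡⟨ ℤP.*-identityˡ (+ c) ⟩
      + c
        ∎
      where
      factor : ∀ ρ τ m c → ρ * c * c + τ * (m * c) ≡ (m * τ + c * ρ) * c
      factor = solve-∀
    c∣f· : ∀ x → + c ∣ᶻ form d (((ρ * + c) · x₀) ⊕ (τ · f′)) x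
    c∣f· x = subst (+ c ∣ᶻ_) (sym (form-lincombˡ (ρ * + c) x₀ τ f′ x))
      (ℤ∣.∣m∣n⇒∣m+n (ℤ∣.∣m⇒∣m*n _ (ℤ∣.∣n⇒∣m*n ρ ℤ∣.∣-refl))
                    (ℤ∣.∣n⇒∣m*n τ (ℤ∣.∣-trans c∣D (D∣f′· x))))

module _ {g : ℕ} (d : Fin (suc g) → ℕ) (d₀≡1 : d zero ≡ 1) where
  open FormProperties d
  open ≡-Reasoning

  e₀ f₀ : Λ (suc g)
  e₀ = single zero (+ 1 , + 0)
  f₀ = single zero (+ 0 , + 1)

  form-e₀ : ∀ x → form d e₀ x ≡ proj₂ (x zero)
  form-e₀ x = begin
    form d e₀ x                          ≡⟨ form-single d zero (+ 1) (+ 0) x ⟩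
    + d zero * (+ 1 * x₀₂ - + 0 * x₀₁)   ≡⟨ cong (λ k → + k * (+ 1 * x₀₂ - + 0 * x₀₁)) d₀≡1 ⟩
    + 1 * (+ 1 * x₀₂ - + 0 * x₀₁)        ≡⟨ simplify x₀₁ x₀₂ ⟩
    x₀₂                                  ∎
    where
    x₀₁ x₀₂ : ℤ
    x₀₁ = proj₁ (x zero)
    x₀₂ = proj₂ (x zero)
    simplify : ∀ x y → + 1 * (+ 1 * y - + 0 * x) ≡ y
    simplify = solve-∀

  -- Primitive as defined holds for the zero vector, so 𝟎 must split as well.
  zero-splitting : ∀ {v} → Primitive v → v ≈ 𝟎 → Splitting d v
  zero-splitting v-primitive v≈𝟎 =
    splitting-criterion d e₀ f₀ v-primitive (subst (_≢ + 0) (sym (form-e₀ f₀)) (λ ()))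
                        (λ x → unit∣ _) (λ x → unit∣ _) (+ 0 , + 0 , v≈𝟎)
    where
    unit∣ : ∀ y → form d e₀ f₀ ∣ᶻ y
    unit∣ y = subst (_∣ᶻ y) (sym (form-e₀ f₀)) (divides y (sym (ℤP.*-identityʳ y)))

  module _ {D : ℕ} (d∣D : ∀ i → d i ∣ D) (D-squareFree : SquareFree D) where
    r : Fin (suc g) → ℕ
    r i = quotient (d∣D i)

    d*r≡D : ∀ i → + d i * + r i ≡ + D
    d*r≡D i = trans (sym (ℤP.pos-* (d i) (r i)))
                    (cong +_ (trans (ℕP.*-comm (d i) (r i)) (sym (ℕ∣._∣_.equality (d∣D i)))))

    form-J-r⊙ : ∀ v ℓ → form d v (J (r ⊙ ℓ)) ≡ + D * dot v ℓ
    form-J-r⊙ v ℓ = begin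
      form d v (J (r ⊙ ℓ))     ≡⟨ form-J v (r ⊙ ℓ) ⟩
      dot (d ⊙ v) (r ⊙ ℓ)      ≡⟨ ∑-cong (λ i → trans (regroup (+ d i) (+ r i) (v i) (ℓ i))
                                                       (cong (_* term i) (d*r≡D i))) ⟩
      ∑ (λ i → + D * term i)   ≡⟨ *-distribˡ-∑ (+ D) term ⟨
      + D * dot v ℓ            ∎
      where
      term : Fin (suc g) → ℤ
      term i = proj₁ (v i) * proj₁ (ℓ i) + proj₂ (v i) * proj₂ (ℓ i)
      regroup : ∀ d r ((v₁ , v₂) (ℓ₁ , ℓ₂) : ℤ × ℤ) →
                d * v₁ * (r * ℓ₁) + d * v₂ * (r * ℓ₂) ≡ d * r * (v₁ * ℓ₁ + v₂ * ℓ₂)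
      regroup d r (v₁ , v₂) (ℓ₁ , ℓ₂) = solve (d ∷ r ∷ v₁ ∷ v₂ ∷ ℓ₁ ∷ ℓ₂ ∷ [])

    D∣form-J-r⊙ : ∀ ℓ x → + D ∣ᶻ form d (J (r ⊙ ℓ)) x
    D∣form-J-r⊙ ℓ = ∣-form (J (r ⊙ ℓ)) λ i →
      D∣d* i (ℤ∣.∣m⇒∣-m (r∣r* i (proj₂ (ℓ i)))) , D∣d* i (r∣r* i (proj₁ (ℓ i)))
      where
      r∣r* : ∀ i y → + r i ∣ᶻ + r i * y
      r∣r* i y = ℤ∣.∣m⇒∣m*n y ℤ∣.∣-refl
      D∣d* : ∀ i {y} → + r i ∣ᶻ y → + D ∣ᶻ + d i * y
      D∣d* i {y} r∣y = subst (_∣ᶻ + d i * y) (d*r≡D i) (ℤ∣.*-monoʳ-∣ (+ d i) r∣y)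

    module _ {v ℓ : Λ (suc g)} (v-primitive : Primitive v) (v·ℓ≡1 : dot v ℓ ≡ + 1)
             {c : ℕ} {z : Λ (suc g)} (c∣dv : + c ∣ᴧ (d ⊙ v)) (dv·z≡c : dot (d ⊙ v) z ≡ + c)
             where
      v·f′≡D : form d v (J (r ⊙ ℓ)) ≡ + D
      v·f′≡D = trans (form-J-r⊙ v ℓ) (trans (cong (+ D *_) v·ℓ≡1) (ℤP.*-identityʳ (+ D)))

      c∣D : c ∣ D
      c∣D = ℤ∣.∣⇒∣ᵤ (subst (+ c ∣ᶻ_) v·f′≡D (∣-form v c∣dv (J (r ⊙ ℓ))))

      c≢0 : c ≢ 0
      c≢0 refl = ¬squareFree-0 (subst SquareFree (ℕ∣.0∣⇒≡0 c∣D) D-squareFree)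

      splitting-from-partner : ∃[ f ] (form d v f ≡ + c × ∀ x → + c ∣ᶻ form d f x) →
                               Splitting d v
      splitting-from-partner (f , v·f≡c , c∣f·) =
        splitting-criterion d v f v-primitive
                            (λ v·f≡0 → c≢0 (ℤP.+-injective (trans (sym v·f≡c) v·f≡0)))
                            (divisor v (∣-form v c∣dv)) (divisor f c∣f·) (+ 1 , + 0 , v≈1v)
        where
        divisor : ∀ y → (∀ x → + c ∣ᶻ form d y x) → ∀ x → form d v f ∣ᶻ form d y x
        divisor y c∣y· x = subst (_∣ᶻ form d y x) (sym v·f≡c) (c∣y· x)
        1*x+0≡x : ∀ x → + 1 * x + + 0 ≡ x
        1*x+0≡x x = trans (ℤP.+-identityʳ (+ 1 * x)) (ℤP.*-identityˡ x)
        v≈1v : v ≈ (((+ 1) · v) ⊕ ((+ 0) · f))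
        v≈1v i = sym (cong₂ _,_ (1*x+0≡x (proj₁ (v i))) (1*x+0≡x (proj₂ (v i))))

      content-splitting : Splitting d v
      content-splitting = splitting-from-partner
        (hyperbolic-partner d v (J z) (J (r ⊙ ℓ)) (trans (form-J v z) dv·z≡c) v·f′≡D
                            (D∣form-J-r⊙ ℓ) c∣D D-squareFree)

    unimodular-splitting : ∀ {v ℓ} → Primitive v → dot v ℓ ≡ + 1 → Splitting d v
    unimodular-splitting {v} {ℓ} v-primitive v·ℓ≡1 = from-content (gcd-combination (d ⊙ v))
      where
      from-content : ∃[ c ] (+ c ∣ᴧ (d ⊙ v) × ∃[ z ] (dot (d ⊙ v) z ≡ + c)) → Splitting d v
      from-content (c , c∣dv , z , dv·z≡c) =
        content-splitting {v} {ℓ} v-primitive v·ℓ≡1 {c} {z} c∣dv dv·z≡c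

    squareFree⇒everyPrimitiveSplits : EveryPrimitiveSplits d
    squareFree⇒everyPrimitiveSplits v v-primitive =
      [ zero-splitting v-primitive
      , (λ (ℓ , v·ℓ≡1) → unimodular-splitting {v} {ℓ} v-primitive v·ℓ≡1)
      ]′ (primitive⇒unimodular v-primitive)

  module _ (j : Fin g) {c p : ℕ} (dⱼ≡cpp : d (suc j) ≡ c ℕ.* p ℕ.* p) where
    C P : ℤ
    C = + (c ℕ.* p)
    P = + p

    eⱼ v : Λ (suc g)
    eⱼ = single (suc j) (+ 1 , + 0)
    v  = (C · e₀) ⊕ ((+ 1) · eⱼ)

    v-entry : proj₁ (v (suc j)) ≡ + 1
    v-entry = cong₂ (λ a b → a + + 1 * proj₁ b) (ℤP.*-zeroʳ C) (single-at j (+ 1 , + 0))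

    v-primitive : Primitive v
    v-primitive = entry≡1⇒primitive v (suc j) v-entry

    form-v : ∀ x → form d v x ≡ C * (proj₂ (x zero) + P * proj₂ (x (suc j)))
    form-v x = begin
      form d v x
        ≡⟨ form-lincombˡ C e₀ (+ 1) eⱼ x ⟩
      C * form d e₀ x + + 1 * form d eⱼ x
        ≡⟨ cong₂ (λ a b → C * a + + 1 * b) (form-e₀ x) (form-single d (suc j) (+ 1) (+ 0) x) ⟩
      C * x₀₂ + + 1 * (+ d (suc j) * (+ 1 * xⱼ₂ - + 0 * xⱼ₁))
        ≡⟨ cong (λ k → C * x₀₂ + + 1 * (k * (+ 1 * xⱼ₂ - + 0 * xⱼ₁))) dⱼ≡CP ⟩
      C * x₀₂ + + 1 * (C * P * (+ 1 * xⱼ₂ - + 0 * xⱼ₁))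
        ≡⟨ simplify C P x₀₂ xⱼ₁ xⱼ₂ ⟩
      C * (x₀₂ + P * xⱼ₂)
        ∎
      where
      x₀₂ xⱼ₁ xⱼ₂ : ℤ
      x₀₂ = proj₂ (x zero)
      xⱼ₁ = proj₁ (x (suc j))
      xⱼ₂ = proj₂ (x (suc j))
      dⱼ≡CP : + d (suc j) ≡ C * P
      dⱼ≡CP = trans (cong +_ dⱼ≡cpp) (ℤP.pos-* (c ℕ.* p) p)
      simplify : ∀ C P y x₁ x₂ →
                 C * y + + 1 * (C * P * (+ 1 * x₂ - + 0 * x₁)) ≡ C * (y + P * x₂)
      simplify = solve-∀

    v-nonsplitting : 1 ℕ.< p → 0 ℕ.< c → ¬ Splitting d v
    v-nonsplitting 1<p 0<c (_ , e , f , _ , (a , b , v≈ab) , decomp , _) =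
      ℕP.<⇒≢ 1<p (sym (ℕ∣.∣1⇒≡1 (ℤ∣.∣⇒∣ᵤ P∣1)))
      where
      c′ : ℤ
      c′ = form d e f
      c′∣v· : ∀ x → c′ ∣ᶻ form d v x
      c′∣v· x = subst (c′ ∣ᶻ_) (sym (form-congˡ x v≈ab)) (decomposes⇒∣-span d e f decomp a b x)
      c′∣C : c′ ∣ᶻ C
      c′∣C = subst (c′ ∣ᶻ_) (trans (form-v f₀) (simplify C P)) (c′∣v· f₀)
        where
        simplify : ∀ C P → C * (+ 1 + P * + 0) ≡ C
        simplify = solve-∀
      c′≢0 : c′ ≢ + 0
      c′≢0 c′≡0 = ℕP.<⇒≢ (ℕP.*-mono-< 0<c (ℕP.<-trans ℕ.z<s 1<p))
                         (sym (ℤP.+-injective (ℤ∣.0∣⇒≡0 (subst (_∣ᶻ C) c′≡0 c′∣C))))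
      P∣C : P ∣ᶻ C
      P∣C = divides (+ c) (ℤP.pos-* c p)
      c′∣e₀·e : c′ ∣ᶻ proj₂ (e zero)
      c′∣e₀·e = subst (c′ ∣ᶻ_) (form-e₀ e) (proj₁ (decomposes⇒∣ d e f decomp e₀))
      c′∣e₀·f : c′ ∣ᶻ proj₂ (f zero)
      c′∣e₀·f = subst (c′ ∣ᶻ_) (form-e₀ f) (proj₂ (decomposes⇒∣ d e f decomp e₀))
      a·c′≡ : a * c′ ≡ C * (proj₂ (f zero) + P * proj₂ (f (suc j)))
      a·c′≡ = trans (sym (form-span-f a e b f)) (trans (sym (form-congˡ f v≈ab)) (form-v f))
      -b·c′≡ : - b * c′ ≡ C * (proj₂ (e zero) + P * proj₂ (e (suc j)))
      -b·c′≡ = trans (sym (ℤP.neg-distribˡ-* b c′))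
        (trans (sym (form-span-e a e b f)) (trans (sym (form-congˡ e v≈ab)) (form-v e)))
      P∣a : P ∣ᶻ a
      P∣a = ∣-cofactor c′≢0 P∣C c′∣C c′∣e₀·f a·c′≡
      P∣b : P ∣ᶻ b
      P∣b = subst (P ∣ᶻ_) (ℤP.neg-involutive b)
                  (ℤ∣.∣m⇒∣-m (∣-cofactor c′≢0 P∣C c′∣C c′∣e₀·e -b·c′≡))
      P∣1 : P ∣ᶻ + 1
      P∣1 = subst (P ∣ᶻ_) (trans (sym (cong proj₁ (v≈ab (suc j)))) v-entry)
                  (ℤ∣.∣m∣n⇒∣m+n (ℤ∣.∣m⇒∣m*n _ P∣a) (ℤ∣.∣m⇒∣m*n _ P∣b))

  square∣⇒¬everyPrimitiveSplits : ∀ j {p} → 1 ℕ.< p → 0 ℕ.< d (suc j) →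
                                   p ℕ.* p ∣ d (suc j) → ¬ EveryPrimitiveSplits d
  square∣⇒¬everyPrimitiveSplits j {p} 1<p 0<dⱼ (ℕ∣.divides c dⱼ≡c[pp]) split =
    v-nonsplitting j {c} {p} dⱼ≡cpp 1<p 0<c
      (split (v j {c} {p} dⱼ≡cpp) (v-primitive j {c} {p} dⱼ≡cpp))
    where
    dⱼ≡cpp : d (suc j) ≡ c ℕ.* p ℕ.* p
    dⱼ≡cpp = trans dⱼ≡c[pp] (sym (ℕP.*-assoc c p p))
    0<c : 0 ℕ.< c
    0<c = ℕP.n≢0⇒n>0 λ c≡0 →
      ℕP.<⇒≢ 0<dⱼ (sym (trans dⱼ≡c[pp] (cong (ℕ._* (p ℕ.* p)) c≡0)))

  everyPrimitiveSplits⇒squareFree : ∀ j → 0 ℕ.< d (suc j) → EveryPrimitiveSplits d →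
                                    SquareFree (d (suc j))
  everyPrimitiveSplits⇒squareFree j 0<dⱼ _ zero 0∣dⱼ =
    ⊥-elim (ℕP.<⇒≢ 0<dⱼ (sym (ℕ∣.0∣⇒≡0 0∣dⱼ)))
  everyPrimitiveSplits⇒squareFree j 0<dⱼ _ (suc zero) _ = refl
  everyPrimitiveSplits⇒squareFree j 0<dⱼ split (suc (suc k)) kk∣dⱼ =
    ⊥-elim (square∣⇒¬everyPrimitiveSplits j {suc (suc k)} (ℕ.s≤s (ℕ.s≤s ℕ.z≤n)) 0<dⱼ kk∣dⱼ split)

DivisorChain : ∀ {m} → (Fin (suc m) → ℕ) → Set
DivisorChain {m} d = ∀ (i : Fin m) → d (inject₁ i) ∣ d (suc i)

chain-∣ : ∀ {m} (d : Fin (suc m) → ℕ) → DivisorChain d → ∀ {i j} → i Fin.≤ j → d i ∣ d j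
chain-∣ d ch {zero} {zero} _ = ℕ∣.∣-refl
chain-∣ {suc m} d ch {zero} {suc j} _ =
  ℕ∣.∣-trans (chain-∣ (d ∘ inject₁) (ch ∘ inject₁) {zero} {j} ℕ.z≤n) (ch j)
chain-∣ {suc m} d ch {suc i} {suc j} (ℕ.s≤s i≤j) = chain-∣ (d ∘ suc) (ch ∘ suc) i≤j

module _ {m : ℕ} (d : Fin (suc (suc m)) → ℕ) (ch : DivisorChain d) where
  ratio : Fin m → ℕ
  ratio k = quotient (ch (suc k))

  ratio∣d : ∀ k → ratio k ∣ d (suc (suc k))
  ratio∣d k = ℕ∣.divides (d (suc (inject₁ k)))
                         (trans (ℕ∣._∣_.equality (ch (suc k))) (ℕP.*-comm (ratio k) _))

  ratio*ratio∣last : ∀ {k l} → k Fin.< l → ratio k ℕ.* ratio l ∣ d (fromℕ (suc m))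
  ratio*ratio∣last {k} {l} k<l =
    ℕ∣.∣-trans (ℕ∣.∣-trans (ℕ∣.*-pres-∣ rₖ∣dₗ (ℕ∣.∣-refl {ratio l})) dₗ*rₗ∣dₗ₊₁)
               (chain-∣ d ch (FinP.≤fromℕ (suc (suc l))))
    where
    k+2≤l+1 : suc (suc k) Fin.≤ suc (inject₁ l)
    k+2≤l+1 = ℕ.s≤s (subst (ℕ._≤_ (suc (Fin.toℕ k))) (sym (FinP.toℕ-inject₁ l)) k<l)
    rₖ∣dₗ : ratio k ∣ d (suc (inject₁ l))
    rₖ∣dₗ = ℕ∣.∣-trans (ratio∣d k) (chain-∣ d ch k+2≤l+1)
    dₗ*rₗ∣dₗ₊₁ : d (suc (inject₁ l)) ℕ.* ratio l ∣ d (suc (suc l))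
    dₗ*rₗ∣dₗ₊₁ = ℕ∣.∣-reflexive (trans (ℕP.*-comm _ (ratio l)) (sym (ℕ∣._∣_.equality (ch (suc l)))))

  squareFree-last⇒ratios : SquareFree (d (fromℕ (suc m))) →
    (∀ k → SquareFree (ratio k)) × (∀ k l → k ≢ l → Coprime (ratio k) (ratio l))
  squareFree-last⇒ratios sf =
    (λ k → squareFree-∣ (ℕ∣.∣-trans (ratio∣d k) (chain-∣ d ch (FinP.≤fromℕ _))) sf) , coprime
    where
    coprime : ∀ k l → k ≢ l → Coprime (ratio k) (ratio l)
    coprime k l k≢l {i} (i∣rₖ , i∣rₗ) with FinP.<-cmp k l
    ... | tri< k<l _ _ = sf i (ℕ∣.∣-trans (ℕ∣.*-pres-∣ i∣rₖ i∣rₗ) (ratio*ratio∣last k<l))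
    ... | tri≈ _ k≡l _ = ⊥-elim (k≢l k≡l)
    ... | tri> _ _ l<k = sf i (ℕ∣.∣-trans (ℕ∣.*-pres-∣ i∣rₗ i∣rₖ) (ratio*ratio∣last l<k))

coprime-last : ∀ {m} (d : Fin (suc (suc m)) → ℕ) (ch : DivisorChain d) → d (suc zero) ≡ 1 →
               ∀ {x} → (∀ k → Coprime (ratio d ch k) x) → Coprime (d (fromℕ (suc m))) x
coprime-last {zero} d ch d₁≡1 {x} _ =
  subst (λ n → Coprime n x) (sym d₁≡1) (Coprimality.1-coprimeTo x)
coprime-last {suc m} d ch d₁≡1 {x} r⊥x =
  subst (λ n → Coprime n x) (sym (ℕ∣._∣_.equality (ch (fromℕ (suc m)))))
        (coprime-* (r⊥x (fromℕ m)) (coprime-last (d ∘ inject₁) (ch ∘ inject₁) d₁≡1 (r⊥x ∘ inject₁)))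

ratios⇒squareFree-last : ∀ {m} (d : Fin (suc (suc m)) → ℕ) (ch : DivisorChain d) →
  d (suc zero) ≡ 1 → (∀ k → SquareFree (ratio d ch k)) →
  (∀ k l → k ≢ l → Coprime (ratio d ch k) (ratio d ch l)) → SquareFree (d (fromℕ (suc m)))
ratios⇒squareFree-last {zero} d ch d₁≡1 _ _ = subst SquareFree (sym d₁≡1) squareFree-1
ratios⇒squareFree-last {suc m} d ch d₁≡1 sf coprime =
  subst SquareFree (sym (ℕ∣._∣_.equality (ch (fromℕ (suc m)))))
        (squareFree-* (sf (fromℕ m)) init-squareFree (Coprimality.sym init⊥last-ratio))
  where
  init-squareFree : SquareFree (d (inject₁ (fromℕ (suc m))))
  init-squareFree = ratios⇒squareFree-last (d ∘ inject₁) (ch ∘ inject₁) d₁≡1 (sf ∘ inject₁)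
    (λ k l k≢l → coprime (inject₁ k) (inject₁ l) (k≢l ∘ FinP.inject₁-injective))
  init⊥last-ratio : Coprime (d (inject₁ (fromℕ (suc m)))) (ratio d ch (fromℕ m))
  init⊥last-ratio = coprime-last (d ∘ inject₁) (ch ∘ inject₁) d₁≡1
    (λ k → coprime (inject₁ k) (fromℕ m) (FinP.fromℕ≢inject₁ ∘ sym))

corollary3p4 : (m : ℕ) (d : Fin (suc (suc m)) → ℕ) (t : IsType d) →
    d zero ≡ 1 → d (suc zero) ≡ 1 →
    ((∀ (v : Λ (suc (suc m))) → Primitive v → Splitting d v) ⇔
     ((∀ (k : Fin m) → SquareFree (quotient (IsType.chain t (suc k)))) ×
      (∀ (k l : Fin m) → k ≢ l →
         Coprime (quotient (IsType.chain t (suc k))) (quotient (IsType.chain t (suc l))))))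
corollary3p4 m d t d₀≡1 d₁≡1 = mk⇔
  (λ split → squareFree-last⇒ratios d chain (everyPrimitiveSplits⇒squareFree d d₀≡1 (fromℕ m)
                                               (positive (fromℕ (suc m))) split))
  (λ (sf , coprime) → squareFree⇒everyPrimitiveSplits d d₀≡1
                        (λ i → chain-∣ d chain (FinP.≤fromℕ i))
                        (ratios⇒squareFree-last d chain d₁≡1 sf coprime))
  where open IsType t
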